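{- Let $t$ be a positive integer, $s\ge 2$, and let $G=K(n_1,\dots,n_s)$ be a complete $s$-partite graph with $n_1\ge n_2\ge\cdots\ge n_s$. If $n_1\ge 2t$ then $\beta_t(G)=n_1$, and if $n_1\le 2t$ then $\beta_t(G)\le 2t$.
   Context: $K(n_1,\dots,n_s)$ denotes the complete $s$-partite graph whose parts $V_1,\dots,V_s$ have $n_1,\dots,n_s$ vertices (positive integers). A set $S$ of vertices of a graph is $t$-sparse if the induced subgraph on $S$ has maximum degree at most $t$; $\beta_t(G)$ is the maximum size of a $t$-sparse set of $G$. -}

module Defs where

open import Data.Nat using (ℕ; _≤_)
open import Data.Fin using (Fin)
open import Data.Fin.Properties using (_≟_)
open import Data.Product using (Σ; ∃; _×_; proj₁)
open import Data.List using (List; length; filter)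
open import Data.List.Relation.Unary.All using (All)
open import Data.List.Relation.Unary.Unique.Propositional using (Unique)
open import Relation.Binary.PropositionalEquality using (_≡_; _≢_)
open import Relation.Nullary using (Dec; ¬?)
open import Relation.Unary using (Decidable)

record Graph : Set₁ where
  field
    V    : Set
    Adj  : V → V → Set
    adj? : (u v : V) → Dec (Adj u v)

open Graph public

degIn : (G : Graph) → List (V G) → V G → ℕ
degIn G S v = length (filter (adj? G v) S)

IsSparse : (G : Graph) → ℕ → List (V G) → Set
IsSparse G t S = Unique S × All (λ v → degIn G S v ≤ t) S

IsBeta : (G : Graph) → ℕ → ℕ → Set
IsBeta G t m =
  (∃ λ S → IsSparse G t S × length S ≡ m) × (∀ S → IsSparse G t S → length S ≤ m)

BetaAtMost : (G : Graph) → ℕ → ℕ → Set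
BetaAtMost G t m = ∀ S → IsSparse G t S → length S ≤ m

K : (s : ℕ) → (Fin s → ℕ) → Graph
K s n = record
  { V    = Σ (Fin s) (λ i → Fin (n i))
  ; Adj  = λ u v → proj₁ u ≢ proj₁ v
  ; adj? = λ u v → ¬? (proj₁ u ≟ proj₁ v)
  }

-- A t-sparse set lying inside one part V_i has at most n_i ≤ n_1 vertices, and V_1 itself is
-- t-sparse (it is independent). A t-sparse set S meeting two distinct parts V_i and V_j,
-- at vertices u ∈ V_i and v ∈ V_j, is small: the degree of u in S is |S| − |S ∩ V_i|, so
-- 2|S| = |S ∩ V_i| + |S ∩ V_j| + deg u + deg v ≤ |S| + 2t.
module Submission where

open import Defs
open import Data.Nat using (ℕ; suc; _≤_; _*_)
open import Data.Fin using (Fin; zero)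
open import Data.Fin as F using ()
open import Data.Product using (_×_)

open import Level using (Level)
open import Function using (_∘_; id)
open import Data.Bool using (true; false)
open import Data.Empty using (⊥; ⊥-elim)
open import Data.Nat using (_+_; z≤n; s≤s)
open import Data.Nat.Properties
  using (≤-trans; m≤n⇒m≤1+n; +-suc; +-identityʳ; +-mono-≤; +-cancelˡ-≤; +-commutativeSemigroup; module ≤-Reasoning)
open import Algebra.Properties.CommutativeSemigroup +-commutativeSemigroup using (interchange)
open import Data.Fin.Properties using (_≟_)
open import Data.Product using (Σ; _,_; proj₁)
open import Data.Sum using (_⊎_; inj₁; inj₂; [_,_]′)
open import Data.List using (List; []; _∷_; _++_; length; filter; map; allFin)
open import Data.List.Properties using (length-++; length-map; length-tabulate; filter-none)
open import Data.List.Relation.Unary.All as All using (All; all?)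
open import Data.List.Relation.Unary.All.Properties using (¬All⇒Any¬; map⁺)
open import Data.List.Relation.Unary.Any using (here; there)
open import Data.List.Relation.Unary.Unique.Propositional using (Unique; _∷_)
open import Data.List.Relation.Unary.Unique.Propositional.Properties using (allFin⁺)
  renaming (map⁺ to Unique-map⁺)
open import Data.List.Membership.Propositional using (find)
open import Data.List.Membership.Propositional.Properties using (∈-∃++; ∈-++⁺ˡ; ∈-++⁺ʳ; ∈-++⁻; ∈-map⁺; ∈-allFin)
open import Data.List.Relation.Binary.Subset.Propositional using (_⊆_)
open import Relation.Binary.PropositionalEquality using (_≡_; _≢_; refl; sym; trans; cong; cong₂; subst)
open import Relation.Nullary using (does; yes; no)
open import Relation.Unary using (Pred; Decidable)
open import Relation.Unary.Properties using (∁?)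

private
  variable
    a p q : Level
    A : Set a

module _ {P : Pred A p} (P? : Decidable P) where

  length-filter+length-filter-∁ : ∀ xs → length (filter P? xs) + length (filter (∁? P?) xs) ≡ length xs
  length-filter+length-filter-∁ [] = refl
  length-filter+length-filter-∁ (x ∷ xs) with does (P? x)
  ... | true  = cong suc (length-filter+length-filter-∁ xs)
  ... | false = trans (+-suc _ _) (cong suc (length-filter+length-filter-∁ xs))

module _ {P : Pred A p} {Q : Pred A q} (P? : Decidable P) (Q? : Decidable Q) where

  length-filter+length-filter-disjoint : (∀ {x} → P x → Q x → ⊥) →
    ∀ xs → length (filter P? xs) + length (filter Q? xs) ≤ length xs
  length-filter+length-filter-disjoint P∩Q=∅ [] = z≤n
  length-filter+length-filter-disjoint P∩Q=∅ (x ∷ xs) with P? x | Q? x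
  ... | yes px | yes qx = ⊥-elim (P∩Q=∅ px qx)
  ... | yes _  | no _   = s≤s (length-filter+length-filter-disjoint P∩Q=∅ xs)
  ... | no _   | yes _  = subst (_≤ suc (length xs)) (sym (+-suc _ _))
                            (s≤s (length-filter+length-filter-disjoint P∩Q=∅ xs))
  ... | no _   | no _   = m≤n⇒m≤1+n (length-filter+length-filter-disjoint P∩Q=∅ xs)

Unique∧⊆⇒length≤ : {xs ys : List A} → Unique xs → xs ⊆ ys → length xs ≤ length ys
Unique∧⊆⇒length≤ {xs = []} _ _ = z≤n
Unique∧⊆⇒length≤ {xs = x ∷ xs} (x∉xs ∷ unique) xs⊆ys with us , vs , refl ← ∈-∃++ (xs⊆ys (here refl)) =
  subst (suc (length xs) ≤_) (sym length-us++x∷vs) (s≤s (Unique∧⊆⇒length≤ unique xs⊆us++vs))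
  where
  length-us++x∷vs : length (us ++ x ∷ vs) ≡ suc (length (us ++ vs))
  length-us++x∷vs = trans (length-++ us) (trans (+-suc (length us) (length vs)) (cong suc (sym (length-++ us))))

  xs⊆us++vs : xs ⊆ us ++ vs
  xs⊆us++vs y∈xs with ∈-++⁻ us (xs⊆ys (there y∈xs))
  ... | inj₁ y∈us         = ∈-++⁺ˡ y∈us
  ... | inj₂ (here refl)  = ⊥-elim (All.lookup x∉xs y∈xs refl)
  ... | inj₂ (there y∈vs) = ∈-++⁺ʳ us y∈vs

module CompleteMultipartite {s : ℕ} (n : Fin s → ℕ) where

  Vertex : Set
  Vertex = V (K s n)

  inPart? : (i : Fin s) → Decidable (λ (u : Vertex) → i ≡ proj₁ u)
  inPart? i u = i ≟ proj₁ u

  partSize : Fin s → List Vertex → ℕ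
  partSize i S = length (filter (inPart? i) S)

  part : Fin s → List Vertex
  part i = map (i ,_) (allFin (n i))

  length-part : ∀ i → length (part i) ≡ n i
  length-part i = trans (length-map {B = Vertex} (i ,_) (allFin (n i))) (length-tabulate id)

  part-inPart : ∀ i → All ((i ≡_) ∘ proj₁) (part i)
  part-inPart i = map⁺ (All.universal (λ _ → refl) (allFin (n i)))

  inPart⇒⊆part : ∀ {i S} → All ((i ≡_) ∘ proj₁) S → S ⊆ part i
  inPart⇒⊆part inPart u∈S with All.lookup inPart u∈S
  inPart⇒⊆part {i} _ {.i , k} _ | refl = ∈-map⁺ (i ,_) (∈-allFin k)

  inPart⇒length≤ : ∀ {i S} → Unique S → All ((i ≡_) ∘ proj₁) S → length S ≤ n i
  inPart⇒length≤ {i} unique inPart =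
    subst (_ ≤_) (length-part i) (Unique∧⊆⇒length≤ unique (inPart⇒⊆part inPart))

  degIn+partSize : ∀ S v → partSize (proj₁ v) S + degIn (K s n) S v ≡ length S
  degIn+partSize S v = length-filter+length-filter-∁ (inPart? (proj₁ v)) S

  degIn-inPart : ∀ {S} v → All ((proj₁ v ≡_) ∘ proj₁) S → degIn (K s n) S v ≡ 0
  degIn-inPart v inPart = cong length (filter-none (adj? (K s n) v) (All.map (λ same differ → differ same) inPart))

  part-isSparse : ∀ t i → IsSparse (K s n) t (part i)
  part-isSparse t i = Unique-map⁺ {B = Vertex} (λ { refl → refl }) (allFin⁺ (n i)) , All.map (λ {v} → degree≤t v) (part-inPart i)
    where
    degree≤t : ∀ v → i ≡ proj₁ v → degIn (K s n) (part i) v ≤ t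
    degree≤t v i≡v = subst (_≤ t) (sym (degIn-inPart v (All.map (trans (sym i≡v)) (part-inPart i)))) z≤n

  partSize+partSize≤length : ∀ {i j} → i ≢ j → ∀ S → partSize i S + partSize j S ≤ length S
  partSize+partSize≤length i≢j = length-filter+length-filter-disjoint (inPart? _) (inPart? _)
                                   (λ i≡u j≡u → i≢j (trans i≡u (sym j≡u)))

  twoParts⇒length≤2t : ∀ {t S u v} → proj₁ u ≢ proj₁ v →
    degIn (K s n) S u ≤ t → degIn (K s n) S v ≤ t → length S ≤ 2 * t
  twoParts⇒length≤2t {t} {S} {u} {v} u≢v deg-u≤t deg-v≤t = +-cancelˡ-≤ (length S) _ _ (begin
    length S + length S                 ≡⟨ cong₂ _+_ (sym (degIn+partSize S u)) (sym (degIn+partSize S v)) ⟩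
    (pᵤ + dᵤ) + (pᵥ + dᵥ)               ≡⟨ interchange pᵤ dᵤ pᵥ dᵥ ⟩
    (pᵤ + pᵥ) + (dᵤ + dᵥ)               ≤⟨ +-mono-≤ (partSize+partSize≤length u≢v S) (+-mono-≤ deg-u≤t deg-v≤t) ⟩
    length S + (t + t)                  ≡⟨ cong (λ t′ → length S + (t + t′)) (sym (+-identityʳ t)) ⟩
    length S + 2 * t                    ∎)
    where
    open ≤-Reasoning
    pᵤ = partSize (proj₁ u) S
    pᵥ = partSize (proj₁ v) S
    dᵤ = degIn (K s n) S u
    dᵥ = degIn (K s n) S v

  isSparse⇒length≤part⊎length≤2t : ∀ {t S} → IsSparse (K s n) t S →
    (Σ (Fin s) λ i → length S ≤ n i) ⊎ length S ≤ 2 * t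
  isSparse⇒length≤part⊎length≤2t {S = []} _ = inj₂ z≤n
  isSparse⇒length≤part⊎length≤2t {S = v ∷ S} (unique , sparse) with all? (inPart? (proj₁ v)) (v ∷ S)
  ... | yes inPart = inj₁ (proj₁ v , inPart⇒length≤ unique inPart)
  ... | no ¬inPart with w , w∈S , v≢w ← find (¬All⇒Any¬ (inPart? (proj₁ v)) (v ∷ S) ¬inPart) =
    inj₂ (twoParts⇒length≤2t {S = v ∷ S} {v} {w} v≢w (All.lookup sparse (here refl)) (All.lookup sparse w∈S))

corollary2p2 : (t s : ℕ) → 1 ≤ t → 1 ≤ s → (n : Fin (suc s) → ℕ) →
    (∀ i → 1 ≤ n i) → (∀ i j → i F.≤ j → n j ≤ n i) →
    (2 * t ≤ n zero → IsBeta (K (suc s) n) t (n zero)) ×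
    (n zero ≤ 2 * t → BetaAtMost (K (suc s) n) t (2 * t))
corollary2p2 t s _ _ n _ antitone = β≡n₁ , β≤2t
  where
  open CompleteMultipartite n

  length≤n₁⊎length≤2t : ∀ S → IsSparse (K (suc s) n) t S → length S ≤ n zero ⊎ length S ≤ 2 * t
  length≤n₁⊎length≤2t S sparse with isSparse⇒length≤part⊎length≤2t sparse
  ... | inj₁ (i , ≤nᵢ) = inj₁ (≤-trans ≤nᵢ (antitone zero i z≤n))
  ... | inj₂ ≤2t       = inj₂ ≤2t

  β≡n₁ : 2 * t ≤ n zero → IsBeta (K (suc s) n) t (n zero)
  β≡n₁ 2t≤n₁ = (part zero , part-isSparse t zero , length-part zero)
             , λ S sparse → [ id , (λ ≤2t → ≤-trans ≤2t 2t≤n₁) ]′ (length≤n₁⊎length≤2t S sparse)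

  β≤2t : n zero ≤ 2 * t → BetaAtMost (K (suc s) n) t (2 * t)
  β≤2t n₁≤2t S sparse = [ (λ ≤n₁ → ≤-trans ≤n₁ n₁≤2t) , id ]′ (length≤n₁⊎length≤2t S sparse)
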